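{- Let $G$ be a regular Steinhaus graph of odd degree $n$ on $2n\geq4$ vertices $V_1,\ldots,V_{2n}$. Then $G\setminus\{V_1,V_{2n}\}$ is a regular Steinhaus graph of even degree $n-1$ whose associated Steinhaus matrix is multi-symmetric.
   Context: A Steinhaus matrix of size $m\geq1$ is a matrix $M=(a_{i,j})_{1\leq i,j\leq m}$ with entries in $\mathbb{F}_2=\{0,1\}$ such that $a_{i,i}=0$ for all $i$, $a_{i,j}=a_{i-1,j-1}+a_{i-1,j}$ (addition in $\mathbb{F}_2$) for all $2\leq i<j\leq m$, and $a_{i,j}=a_{j,i}$ for all $i,j$. A Steinhaus graph is a simple graph on labelled vertices $V_1,\ldots,V_m$ whose adjacency matrix is a Steinhaus matrix. $G\setminus\{V_1,V_{2n}\}$ denotes the graph obtained by deleting $V_1$ and $V_{2n}$ and their incident edges (its adjacency matrix is $(a_{i,j})_{2\leq i,j\leq 2n-1}$, with vertices relabelled in order). A square matrix $(a_{i,j})$ of size $m$ is doubly-symmetric if $a_{i,j}=a_{j,i}=a_{m-j+1,m-i+1}$ for all $i,j$; it is multi-symmetric if it is doubly-symmetric and $a_{i,j}=a_{i,m-j+i+1}$ for all $1\leq i<j\leq m$. -}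

module Defs where

open import Data.Nat using (ℕ; zero; suc; _+_; _∸_; _<_; _≤_; _<?_)
open import Data.Bool using (Bool; true; false; _xor_)
open import Data.Fin using (Fin; toℕ; fromℕ<; inject₁)
open import Data.Fin.Properties using ()
open import Data.Vec using (tabulate; count)
open import Relation.Nullary using (yes; no)
open import Relation.Binary.PropositionalEquality using (_≡_)
open import Data.Product using (_×_)
open import Data.Bool.Properties using (T?)
open import Data.Bool using (T)

-- Square matrices over F₂ = Bool (addition in F₂ is _xor_), indexed 0-based.
Matrix : ℕ → Set
Matrix m = Fin m → Fin m → Bool

-- Entry access by natural-number indices (0-based); out-of-range gives false
-- (only ever used with in-range indices below).
at : ∀ {m} → Matrix m → ℕ → ℕ → Bool
at {m} M i j with i <? m | j <? m
... | yes i< | yes j< = M (fromℕ< i<) (fromℕ< j<)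
... | _ | _ = false

-- Steinhaus matrix (0-based translation of the paper's definition):
--  a_{i,i} = 0, a_{i,j} = a_{i-1,j-1} + a_{i-1,j} for 2 ≤ i < j ≤ m,
--  a_{i,j} = a_{j,i}.
record IsSteinhaus {m : ℕ} (M : Matrix m) : Set where
  field
    diag : ∀ i → M i i ≡ false
    sym  : ∀ i j → M i j ≡ M j i
    rule : ∀ i j → 1 ≤ i → i < j → j < m →
           at M i j ≡ (at M (i ∸ 1) (j ∸ 1) xor at M (i ∸ 1) j)

degree : ∀ {m} → Matrix m → Fin m → ℕ
degree M i = count (λ b → T? b) (tabulate (M i))

IsRegular : ∀ {m} → Matrix m → ℕ → Set
IsRegular M d = ∀ i → degree M i ≡ d

IsDoublySymmetric : ∀ {m} → Matrix m → Set
IsDoublySymmetric {m} M =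
  ∀ i j → i < m → j < m →
    (at M i j ≡ at M j i) × (at M i j ≡ at M (m ∸ 1 ∸ j) (m ∸ 1 ∸ i))

-- Multi-symmetric: doubly-symmetric and, for 1 ≤ i < j ≤ m (1-based),
-- a_{i,j} = a_{i, m-j+i+1}; in 0-based indices i' < j' < m:
-- a_{i',j'} = a_{i', m - j' + i'}.
IsMultiSymmetric : ∀ {m} → Matrix m → Set
IsMultiSymmetric {m} M =
  IsDoublySymmetric M ×
  (∀ i j → i < j → j < m → at M i j ≡ at M i (m ∸ j + i))

-- G \ {V_1, V_{2n}} for a matrix of size suc (suc p): drop first and last index.
deleteEnds : ∀ {p} → Matrix (suc (suc p)) → Matrix p
deleteEnds M i j = M (Fin.suc (inject₁ i)) (Fin.suc (inject₁ j))

-- Write a(i,j) for the entries, indexed 0..L with L = 2n − 1, so that the Steinhaus rule reads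
-- a(i+1,j+1) = a(i,j) + a(i,j+1). Telescoping this rule down a column and along a row gives the
-- parity of row v+1 as a(0,v+2) + a(v,v+2) + a(v,L). Since n is odd, every row has odd parity, and
-- propagating these relations through a triangle of Pascal-type sums shows that the last column is
-- the complement of the reversed first row: a(s,L) = 1 + a(0,L−s) for 0 < s < L.
-- A Steinhaus matrix is determined by its first row, and both the transpose along the
-- antidiagonal and the reflection j ↦ m − j + i within rows again satisfy the Steinhaus rule. So the
-- inner matrix, whose first row is its reversed last column, is doubly symmetric; hence rows s and
-- L − s have the same inner degree, and comparing their total degrees n forces a(0,s) = a(0,L−s)
-- and inner degree n − 1. The palindromic first row then propagates to multi-symmetry.

module Submission where

open import Defs
open import Data.Nat using (ℕ; zero; suc; _+_; _≤_; _<_; _>_; _∸_; z≤n; s≤s; s≤s⁻¹; _<?_)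
open import Data.Nat.Properties
open import Data.Nat.Divisibility using (_∣_; divides)
open import Data.Nat.Tactic.RingSolver using (solve-∀)
open import Data.Bool using (Bool; true; false; not; _xor_; if_then_else_)
open import Data.Bool.Properties using (T?; xor-same; xor-comm; xor-assoc; xor-inverseʳ; xor-annihilates-not; not-involutive)
open import Data.Bool.Solver using (module xor-∧-Solver)
open import Data.Fin using (Fin; toℕ; fromℕ<; inject₁)
open import Data.Fin.Properties using (toℕ<n; fromℕ<-toℕ; toℕ-fromℕ<; toℕ-inject₁; toℕ-injective)
open import Data.Vec using (tabulate; count)
open import Data.Product using (_×_; _,_; proj₁; proj₂)
open import Data.Empty using (⊥-elim)
open import Relation.Nullary using (¬_; yes; no; does)
open import Relation.Binary using (Tri; tri<; tri≈; tri>)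
open import Relation.Binary.PropositionalEquality
open import Function using (_∘_; id; _$_)

open xor-∧-Solver using (solve; _:+_; _:=_; con)

bit : Bool → ℕ
bit false = 0
bit true  = 1

oddᵇ : ℕ → Bool
oddᵇ zero    = false
oddᵇ (suc n) = not (oddᵇ n)

ones : (ℕ → Bool) → ℕ → ℕ
ones f zero    = 0
ones f (suc n) = bit (f 0) + ones (f ∘ suc) n

xorSum : (ℕ → Bool) → ℕ → Bool
xorSum f zero    = false
xorSum f (suc n) = f 0 xor xorSum (f ∘ suc) n

∸-suc : ∀ {m n} → n < m → m ∸ n ≡ suc (m ∸ suc n)
∸-suc n<m = +-∸-assoc 1 n<m

+-suc-suc : ∀ m n → m + suc (suc n) ≡ suc (suc (m + n))
+-suc-suc m n = trans (+-suc m (suc n)) (cong suc (+-suc m n))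

≤-of-sum : ∀ {a b c} → a + b ≡ c → a ≤ c
≤-of-sum {a} {b} e = subst (a ≤_) e (m≤m+n a b)

xor-transpose : ∀ {a b c} → a ≡ b xor c → b ≡ a xor c
xor-transpose {b = b} {c = c} refl = solve 2 (λ b c → b := (b :+ c) :+ c) refl b c

xor≡true⇒≡not : ∀ {a b} → a xor b ≡ true → a ≡ not b
xor≡true⇒≡not {false} {true}  _ = refl
xor≡true⇒≡not {true}  {false} _ = refl

bits-balance : ∀ {x y d n} → bit x + d + bit (not y) ≡ suc n → bit y + d + bit (not x) ≡ suc n →
  x ≡ y × d ≡ n
bits-balance {true}  {true}  {d} e _ = refl , suc-injective (trans (sym (+-identityʳ (suc d))) e)
bits-balance {false} {false} {d} e _ = refl , suc-injective (trans (+-comm 1 d) e)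
bits-balance {true}  {false} {d} {n} e e' =
  ⊥-elim (1+n≰n (subst (_≤ n) (trans (sym (+-identityʳ d)) e') (≤-of-sum (suc-injective e))))
bits-balance {false} {true}  {d} {n} e e' =
  ⊥-elim (1+n≰n (subst (_≤ n) (trans (sym (+-identityʳ d)) e) (≤-of-sum (suc-injective e'))))

oddᵇ-bit+ : ∀ b n → oddᵇ (bit b + n) ≡ b xor oddᵇ n
oddᵇ-bit+ false n = refl
oddᵇ-bit+ true  n = refl

oddᵇ-ones : ∀ f n → oddᵇ (ones f n) ≡ xorSum f n
oddᵇ-ones f zero    = refl
oddᵇ-ones f (suc n) = trans (oddᵇ-bit+ (f 0) _) (cong (f 0 xor_) (oddᵇ-ones (f ∘ suc) n))

oddᵇ-double : ∀ n → oddᵇ (n + n) ≡ false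
oddᵇ-double zero    = refl
oddᵇ-double (suc n) rewrite +-suc n n = trans (not-involutive _) (oddᵇ-double n)

oddᵇ-false⇒even : ∀ n → oddᵇ n ≡ false → 2 ∣ n
oddᵇ-false⇒even zero          _ = divides 0 refl
oddᵇ-false⇒even (suc zero)    ()
oddᵇ-false⇒even (suc (suc n)) e with oddᵇ-false⇒even n (trans (sym (not-involutive _)) e)
... | divides q n≡q*2 = divides (suc q) (cong (suc ∘ suc) n≡q*2)

oddᵇ-¬even : ∀ n → ¬ 2 ∣ n → oddᵇ n ≡ true
oddᵇ-¬even n ¬2∣n with oddᵇ n in eq
... | true  = refl
... | false = ⊥-elim (¬2∣n (oddᵇ-false⇒even n eq))

ones-cong : ∀ {f g} n → (∀ i → i < n → f i ≡ g i) → ones f n ≡ ones g n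
ones-cong zero    f≗g = refl
ones-cong (suc n) f≗g =
  cong₂ _+_ (cong bit (f≗g 0 (s≤s z≤n))) (ones-cong n (λ i i<n → f≗g (suc i) (s≤s i<n)))

xorSum-cong : ∀ {f g} n → (∀ i → i < n → f i ≡ g i) → xorSum f n ≡ xorSum g n
xorSum-cong zero    f≗g = refl
xorSum-cong (suc n) f≗g =
  cong₂ _xor_ (f≗g 0 (s≤s z≤n)) (xorSum-cong n (λ i i<n → f≗g (suc i) (s≤s i<n)))

ones-suc : ∀ f n → ones f (suc n) ≡ ones f n + bit (f n)
ones-suc f zero    = +-comm (bit (f 0)) 0
ones-suc f (suc n) =
  trans (cong (bit (f 0) +_) (ones-suc (f ∘ suc) n)) (sym (+-assoc (bit (f 0)) _ _))

xorSum-suc : ∀ f n → xorSum f (suc n) ≡ xorSum f n xor f n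
xorSum-suc f zero    = xor-comm (f 0) false
xorSum-suc f (suc n) =
  trans (cong (f 0 xor_) (xorSum-suc (f ∘ suc) n)) (sym (xor-assoc (f 0) _ _))

xorSum-+ : ∀ f a b → xorSum f (a + b) ≡ xorSum f a xor xorSum (f ∘ (a +_)) b
xorSum-+ f zero    b = refl
xorSum-+ f (suc a) b =
  trans (cong (f 0 xor_) (xorSum-+ (f ∘ suc) a b)) (sym (xor-assoc (f 0) _ _))

ones-reverse : ∀ f n → ones f n ≡ ones (λ i → f (n ∸ suc i)) n
ones-reverse f zero    = refl
ones-reverse f (suc n) = begin
  ones f (suc n)                          ≡⟨ ones-suc f n ⟩
  ones f n + bit (f n)                    ≡⟨ cong (_+ bit (f n)) (ones-reverse f n) ⟩
  ones (λ i → f (n ∸ suc i)) n + bit (f n) ≡⟨ +-comm _ (bit (f n)) ⟩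
  bit (f n) + ones (λ i → f (n ∸ suc i)) n ∎
  where open ≡-Reasoning

xorSum-reverse : ∀ f n → xorSum f n ≡ xorSum (λ i → f (n ∸ suc i)) n
xorSum-reverse f n =
  trans (sym (oddᵇ-ones f n)) (trans (cong oddᵇ (ones-reverse f n)) (oddᵇ-ones _ n))

xorSum-xor : ∀ f g n → xorSum (λ i → f i xor g i) n ≡ xorSum f n xor xorSum g n
xorSum-xor f g zero    = refl
xorSum-xor f g (suc n) =
  trans (cong ((f 0 xor g 0) xor_) (xorSum-xor (f ∘ suc) (g ∘ suc) n))
        (xor-interchange (f 0) (g 0) _ _)
  where
  xor-interchange : ∀ a b c d → (a xor b) xor (c xor d) ≡ (a xor c) xor (b xor d)
  xor-interchange = solve 4 (λ a b c d → (a :+ b) :+ (c :+ d) := (a :+ c) :+ (b :+ d)) refl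

xorSum-telescope : ∀ f n → xorSum (λ i → f i xor f (suc i)) n ≡ f 0 xor f n
xorSum-telescope f zero    = sym (xor-same (f 0))
xorSum-telescope f (suc n) =
  trans (cong ((f 0 xor f 1) xor_) (xorSum-telescope (f ∘ suc) n)) (cancel (f 0) (f 1) (f (suc n)))
  where
  cancel : ∀ a b c → (a xor b) xor (b xor c) ≡ a xor c
  cancel = solve 3 (λ a b c → (a :+ b) :+ (b :+ c) := a :+ c) refl

xorSum-true : ∀ f n → (∀ i → i < n → f i ≡ true) → xorSum f n ≡ oddᵇ n
xorSum-true f zero    _ = refl
xorSum-true f (suc n) f≡true rewrite f≡true 0 (s≤s z≤n) =
  cong not (xorSum-true (f ∘ suc) n (λ i i<n → f≡true (suc i) (s≤s i<n)))

count-tabulate : ∀ {n} (g : Fin n → Bool) (f : ℕ → Bool) → (∀ j → f (toℕ j) ≡ g j) →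
  count (λ b → T? b) (tabulate g) ≡ ones f n
count-tabulate {zero}  g f f≗g = refl
count-tabulate {suc n} g f f≗g =
  trans (if-bit (g Fin.zero) _)
    (cong₂ _+_ (cong bit (sym (f≗g Fin.zero)))
               (count-tabulate (g ∘ Fin.suc) (f ∘ suc) (f≗g ∘ Fin.suc)))
  where
  if-bit : ∀ b c → (if does (T? b) then suc else id $ c) ≡ bit b + c
  if-bit false c = refl
  if-bit true  c = refl

module _ {m} (M : Matrix m) where

  at-fromℕ< : ∀ {i j} (i<m : i < m) (j<m : j < m) → at M i j ≡ M (fromℕ< i<m) (fromℕ< j<m)
  at-fromℕ< {i} {j} i<m j<m with i <? m | j <? m
  ... | yes _  | yes _  = refl
  ... | no i≮m | _      = ⊥-elim (i≮m i<m)
  ... | yes _  | no j≮m = ⊥-elim (j≮m j<m)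

  at-toℕ : ∀ i j → at M (toℕ i) (toℕ j) ≡ M i j
  at-toℕ i j = trans (at-fromℕ< (toℕ<n i) (toℕ<n j)) (cong₂ M (fromℕ<-toℕ i _) (fromℕ<-toℕ j _))

  degree≡ones : ∀ i → degree M i ≡ ones (at M (toℕ i)) m
  degree≡ones i = count-tabulate (M i) (at M (toℕ i)) (at-toℕ i)

  regular-ones : ∀ {d} → IsRegular M d → ∀ v → v < m → ones (at M v) m ≡ d
  regular-ones R v v<m = trans (cong (λ i → ones (at M i) m) (sym (toℕ-fromℕ< v<m)))
                               (trans (sym (degree≡ones (fromℕ< v<m))) (R (fromℕ< v<m)))

PascalRule : ℕ → (ℕ → ℕ → Bool) → Set
PascalRule n f = ∀ i j → i < j → suc j < n → f (suc i) (suc j) ≡ f i j xor f i (suc j)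

pascal-unique : ∀ {n f g} → PascalRule n f → PascalRule n g →
  (∀ j → 0 < j → j < n → f 0 j ≡ g 0 j) → ∀ i j → i < j → j < n → f i j ≡ g i j
pascal-unique {n} {f} {g} pf pg top = agree
  where
  agree : ∀ i j → i < j → j < n → f i j ≡ g i j
  agree zero    j 0<j j<n = top j 0<j j<n
  agree (suc i) (suc j) i<j j<n =
    trans (pf i j (≤-pred i<j) j<n)
      (trans (cong₂ _xor_ (agree i j (≤-pred i<j) (<-trans (n<1+n j) j<n))
                          (agree i (suc j) (m<n⇒m<1+n (≤-pred i<j)) j<n))
             (sym (pg i j (≤-pred i<j) j<n)))

simplex-pascal-vanishes : ∀ {N} (F : ℕ → ℕ → ℕ → Bool) →
  (∀ t q → t + q ≡ N → F 0 t q ≡ true) →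
  (∀ r t q → suc r + t + q ≡ N → F (suc r) t q ≡ F r t (suc q) xor F r (suc t) q) →
  ∀ r t q → suc r + t + q ≡ N → F (suc r) t q ≡ false
simplex-pascal-vanishes F top step zero t q e
  rewrite step 0 t q e | top t (suc q) (trans (+-suc t q) e) | top (suc t) q e = refl
simplex-pascal-vanishes F top step (suc r) t q e
  rewrite step (suc r) t q e
        | simplex-pascal-vanishes F top step r t (suc q) (trans (+-suc (suc r + t) q) e)
        | simplex-pascal-vanishes F top step r (suc t) q (trans (cong (_+ q) (+-suc (suc r) t)) e)
  = refl

module Steinhaus {m} {M : Matrix m} (S : IsSteinhaus M) where
  open IsSteinhaus S renaming (sym to M-sym)

  at-sym : ∀ i j → at M i j ≡ at M j i
  at-sym i j with i <? m | j <? m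
  ... | yes i<m | yes j<m = M-sym (fromℕ< i<m) (fromℕ< j<m)
  ... | yes _   | no  _   = refl
  ... | no  _   | yes _   = refl
  ... | no  _   | no  _   = refl

  at-diag : ∀ i → at M i i ≡ false
  at-diag i with i <? m
  ... | yes i<m = diag (fromℕ< i<m)
  ... | no  _   = refl

  at-pascal : PascalRule m (at M)
  at-pascal i j i<j j<m = rule (suc i) (suc j) (s≤s z≤n) (s≤s i<j) j<m

module _ {p} {M : Matrix (suc (suc p))} where

  at-deleteEnds : ∀ {i j} → i < p → j < p → at (deleteEnds M) i j ≡ at M (suc i) (suc j)
  at-deleteEnds i<p j<p =
    trans (at-fromℕ< (deleteEnds M) i<p j<p)
      (trans (cong₂ M (shift i<p) (shift j<p)) (sym (at-fromℕ< M (widen i<p) (widen j<p))))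
    where
    widen : ∀ {i} → i < p → suc i < suc (suc p)
    widen i<p = s≤s (m<n⇒m<1+n i<p)
    shift : ∀ {i} (i<p : i < p) → Fin.suc (inject₁ (fromℕ< i<p)) ≡ fromℕ< (widen i<p)
    shift i<p = toℕ-injective (cong suc (trans (toℕ-inject₁ (fromℕ< i<p))
                  (trans (toℕ-fromℕ< i<p) (sym (suc-injective (toℕ-fromℕ< (widen i<p)))))))

  deleteEnds-steinhaus : IsSteinhaus M → IsSteinhaus (deleteEnds M)
  deleteEnds-steinhaus S = record
    { diag = λ i → IsSteinhaus.diag S _
    ; sym  = λ i j → IsSteinhaus.sym S _ _
    ; rule = inner-rule
    }
    where
    open Steinhaus S
    inner-rule : ∀ i j → 1 ≤ i → i < j → j < p →
      at (deleteEnds M) i j ≡ at (deleteEnds M) (i ∸ 1) (j ∸ 1) xor at (deleteEnds M) (i ∸ 1) j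
    inner-rule (suc i) (suc j) _ i<j j<p =
      trans (at-deleteEnds (<-trans i<j j<p) j<p)
        (trans (at-pascal (suc i) (suc j) i<j (s≤s (m<n⇒m<1+n j<p)))
          (sym (cong₂ _xor_ (at-deleteEnds (<-trans (n<1+n i) (<-trans i<j j<p)) (<-trans (n<1+n j) j<p))
                            (at-deleteEnds (<-trans (n<1+n i) (<-trans i<j j<p)) j<p))))

module _ {q} {D : Matrix (suc q)} (S : IsSteinhaus D) where
  open Steinhaus S

  mirror-pascal : PascalRule (suc q) (λ i j → at D (q ∸ j) (q ∸ i))
  mirror-pascal i j i<j (s≤s j<q)
    rewrite ∸-suc j<q | ∸-suc (<-trans i<j j<q) =
    xor-transpose (at-pascal (q ∸ suc j) (q ∸ suc i) (∸-monoʳ-< (s≤s i<j) j<q)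
                             (s≤s (∸-monoʳ-< (s≤s z≤n) (<-trans i<j j<q))))

  doublySymmetric-from-border :
    (∀ j → 0 < j → j < suc q → at D 0 j ≡ at D (q ∸ j) q) → IsDoublySymmetric D
  doublySymmetric-from-border border i j i<m j<m = at-sym i j , mirrored (<-cmp i j)
    where
    below-diagonal : ∀ {i j} → i < j → j < suc q → at D i j ≡ at D (q ∸ j) (q ∸ i)
    below-diagonal = pascal-unique {f = at D} {g = λ i j → at D (q ∸ j) (q ∸ i)}
                       at-pascal mirror-pascal border _ _
    mirrored : Tri (i < j) (i ≡ j) (i > j) → at D i j ≡ at D (q ∸ j) (q ∸ i)
    mirrored (tri< i<j _ _)    = below-diagonal i<j j<m
    mirrored (tri≈ _ refl _)   = trans (at-diag i) (sym (at-diag (q ∸ i)))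
    mirrored (tri> _ _ j<i)    =
      trans (at-sym i j) (trans (below-diagonal j<i i<m) (at-sym (q ∸ i) (q ∸ j)))

module _ {p} {D : Matrix p} (S : IsSteinhaus D) where
  open Steinhaus S

  reflection-pascal : PascalRule p (λ i j → at D i (p ∸ j + i))
  reflection-pascal i j i<j sj<p
    rewrite +-suc (p ∸ suc j) i | ∸-suc (<-trans (n<1+n j) sj<p) =
    trans (at-pascal i (p ∸ suc j + i) i<c c<p)
          (xor-comm (at D i (p ∸ suc j + i)) (at D i (suc (p ∸ suc j + i))))
    where
    i<c : i < p ∸ suc j + i
    i<c = m<n+m i (m<n⇒0<n∸m sj<p)
    c<p : suc (p ∸ suc j + i) < p
    c<p = subst (suc (p ∸ suc j + i) <_) (m∸n+n≡m (<⇒≤ (<-trans (n<1+n j) sj<p)))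
            (subst (_< p ∸ j + j) (cong (_+ i) (∸-suc (<-trans (n<1+n j) sj<p)))
              (+-monoʳ-< (p ∸ j) i<j))

  multiSymmetric-from-palindrome : IsDoublySymmetric D →
    (∀ j → 0 < j → j < p → at D 0 j ≡ at D 0 (p ∸ j)) → IsMultiSymmetric D
  multiSymmetric-from-palindrome doubly palindrome =
    doubly , pascal-unique {f = at D} {g = λ i j → at D i (p ∸ j + i)} at-pascal reflection-pascal
               (λ j 0<j j<p → trans (palindrome j 0<j j<p) (cong (at D 0) (sym (+-identityʳ _))))

module _ {m} {M : Matrix m} (S : IsSteinhaus M) where
  open Steinhaus S

  column-telescope : ∀ c n → n ≤ c → suc c < m →
    xorSum (λ i → at M i c) n ≡ at M 0 (suc c) xor at M n (suc c)
  column-telescope c n n≤c sc<m =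
    trans (xorSum-cong n step) (xorSum-telescope (λ i → at M i (suc c)) n)
    where
    step : ∀ i → i < n → at M i c ≡ at M i (suc c) xor at M (suc i) (suc c)
    step i i<n = trans (xor-transpose (at-pascal i c (<-≤-trans i<n n≤c) sc<m))
                       (xor-comm (at M (suc i) (suc c)) (at M i (suc c)))

  row-telescope : ∀ v n → suc v + n < m →
    xorSum (λ j → at M (suc v) (suc v + suc j)) n ≡ at M v (suc v) xor at M v (suc v + n)
  row-telescope v n v+n<m =
    trans (xorSum-cong n step)
      (trans (xorSum-telescope (λ j → at M v (suc v + j)) n)
             (cong (λ c → at M v c xor at M v (suc v + n)) (cong suc (+-identityʳ v))))
    where
    step : ∀ j → j < n → at M (suc v) (suc v + suc j) ≡ at M v (suc v + j) xor at M v (suc v + suc j)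
    step j j<n rewrite +-suc (suc v) j =
      at-pascal v (suc v + j) (s≤s (m≤m+n v j)) (<-≤-trans (s≤s (+-monoʳ-< (suc v) j<n)) v+n<m)

module _ {L} {M : Matrix (suc L)} (S : IsSteinhaus M) where
  open Steinhaus S

  row-parity : ∀ v n → suc v + suc n ≡ L →
    xorSum (at M (suc v)) (suc L) ≡ at M 0 (suc (suc v)) xor at M v (suc (suc v)) xor at M v L
  row-parity v n sv+sn≡L = begin
    xorSum row (suc L)
      ≡⟨ cong (xorSum row) (sym size) ⟩
    xorSum row (suc v + suc (suc n))
      ≡⟨ xorSum-+ row (suc v) (suc (suc n)) ⟩
    xorSum row (suc v) xor (row (suc v + 0) xor xorSum (λ j → row (suc v + suc j)) (suc n))
      ≡⟨ cong₂ _xor_ left (cong₂ _xor_ diagonal right) ⟩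
    (at M 0 (suc (suc v)) xor (x xor y)) xor (false xor (x xor at M v L))
      ≡⟨ cancel (at M 0 (suc (suc v))) x y (at M v L) ⟩
    at M 0 (suc (suc v)) xor y xor at M v L ∎
    where
    open ≡-Reasoning
    row : ℕ → Bool
    row = at M (suc v)
    x y : Bool
    x = at M v (suc v)
    y = at M v (suc (suc v))
    size : suc v + suc (suc n) ≡ suc L
    size = trans (+-suc (suc v) (suc n)) (cong suc sv+sn≡L)
    ssv<m : suc (suc v) < suc L
    ssv<m = s≤s (subst (suc (suc v) ≤_) sv+sn≡L (m<m+n (suc v) (s≤s z≤n)))
    left : xorSum row (suc v) ≡ at M 0 (suc (suc v)) xor (x xor y)
    left = trans (xorSum-cong (suc v) (λ i _ → at-sym (suc v) i))
             (trans (column-telescope S (suc v) (suc v) ≤-refl ssv<m)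
                    (cong (at M 0 (suc (suc v)) xor_) (at-pascal v (suc v) ≤-refl ssv<m)))
    diagonal : row (suc v + 0) ≡ false
    diagonal = trans (cong row (+-identityʳ (suc v))) (at-diag (suc v))
    right : xorSum (λ j → row (suc v + suc j)) (suc n) ≡ x xor at M v L
    right = trans (row-telescope S v (suc n) (s≤s (≤-reflexive sv+sn≡L)))
                  (cong (λ c → x xor at M v c) sv+sn≡L)
    cancel : ∀ a x y z → (a xor (x xor y)) xor (false xor (x xor z)) ≡ a xor y xor z
    cancel = solve 4 (λ a x y z → (a :+ (x :+ y)) :+ (con false :+ (x :+ z)) := a :+ (y :+ z)) refl

module OddRows {N} {M : Matrix (suc (suc (suc N)))} (S : IsSteinhaus M)
  (odd-rows : ∀ v → v < suc (suc (suc N)) → xorSum (at M v) (suc (suc (suc N))) ≡ true)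
  (N-odd : oddᵇ N ≡ true) where
  open Steinhaus S

  L : ℕ
  L = suc (suc N)

  above : ℕ → ℕ → Bool
  above x d = at M x (x + d)

  above-pascal : ∀ x d → suc x + suc d ≤ L →
    above (suc x) (suc d) ≡ above x (suc d) xor above x (suc (suc d))
  above-pascal x d bound rewrite +-suc x (suc d) =
    at-pascal x (x + suc d) (m<m+n x (s≤s z≤n)) (s≤s bound)

  -- F obeys Pascal's rule in r, and F 0 t q = 1 is the odd parity of row t + 1.
  F : ℕ → ℕ → ℕ → Bool
  F r t q = above t (suc (suc q)) xor above r (suc (suc t)) xor above t (suc (suc r))

  F-top : ∀ t q → t + q ≡ N → F 0 t q ≡ true
  F-top t q t+q≡N =
    trans (cong₂ (λ x z → x xor (at M 0 (suc (suc t)) xor z))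
                 (cong (at M t) (trans (+-suc-suc t q) (cong (suc ∘ suc) t+q≡N)))
                 (cong (at M t) (+-comm t 2)))
      (trans (rotate (at M t L) (at M 0 (suc (suc t))) (at M t (suc (suc t))))
        (trans (sym (row-parity S t q (cong suc (trans (+-suc t q) (cong suc t+q≡N)))))
               (odd-rows (suc t) (s≤s (s≤s (m≤n⇒m≤1+n (≤-of-sum t+q≡N)))))))
    where
    rotate : ∀ a b c → a xor (b xor c) ≡ b xor (c xor a)
    rotate = solve 3 (λ a b c → a :+ (b :+ c) := b :+ (c :+ a)) refl

  F-step : ∀ r t q → suc r + t + q ≡ N → F (suc r) t q ≡ F r t (suc q) xor F r (suc t) q
  F-step r t q e =
    trans (cong (λ x → above t (suc (suc q)) xor x xor above t (suc (suc (suc r))))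
                (above-pascal r (suc t) (bound (sum₁ r t q))))
      (trans (regroup (above t (suc (suc q))) (above t (suc (suc (suc q)))) (above r (suc (suc t)))
                      (above r (suc (suc (suc t)))) (above t (suc (suc r))) (above t (suc (suc (suc r)))))
        (cong₂ (λ x y → F r t (suc q) xor (x xor above r (suc (suc (suc t))) xor y))
               (sym (above-pascal t (suc q) (bound (sum₂ r t q))))
               (sym (above-pascal t (suc r) (bound (sum₃ r t q))))))
    where
    bound : ∀ {a b} → a + b ≡ suc (suc (suc r + t + q)) → a ≤ L
    bound a+b≡ = ≤-of-sum (trans a+b≡ (cong (suc ∘ suc) e))
    sum₁ : ∀ r t q → suc r + suc (suc t) + q ≡ suc (suc (suc r + t + q))
    sum₁ = solve-∀
    sum₂ : ∀ r t q → suc t + suc (suc q) + r ≡ suc (suc (suc r + t + q))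
    sum₂ = solve-∀
    sum₃ : ∀ r t q → suc t + suc (suc r) + q ≡ suc (suc (suc r + t + q))
    sum₃ = solve-∀
    regroup : ∀ a b c d e f →
      a xor (c xor d) xor f ≡ (b xor c xor e) xor ((a xor b) xor d xor (e xor f))
    regroup = solve 6 (λ a b c d e f →
      a :+ ((c :+ d) :+ f) := (b :+ (c :+ e)) :+ ((a :+ b) :+ (d :+ (e :+ f)))) refl

  F-vanishes : ∀ r t q → suc r + t + q ≡ N → F (suc r) t q ≡ false
  F-vanishes = simplex-pascal-vanishes F F-top F-step

  last-column-interior : ∀ r q → suc r + q ≡ N → at M (suc r) L ≡ not (at M 0 (suc (suc q)))
  last-column-interior r q e = trans (cong (at M (suc r)) (sym index)) (xor≡true⇒≡not sum)
    where
    index : suc r + suc (suc q) ≡ L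
    index = trans (+-suc-suc (suc r) q) (cong (suc ∘ suc) e)
    F-pair : F 0 (suc r) q xor F (suc r) 0 q ≡ true
    F-pair = cong₂ _xor_ (F-top (suc r) q e)
                         (F-vanishes r 0 q (trans (cong (_+ q) (+-identityʳ (suc r))) e))
    combine : ∀ a b c d → a xor d ≡ (a xor b xor c) xor (d xor c xor b)
    combine = solve 4 (λ a b c d → a :+ d := (a :+ (b :+ c)) :+ (d :+ (c :+ b))) refl
    sum : above (suc r) (suc (suc q)) xor at M 0 (suc (suc q)) ≡ true
    sum = trans (combine (above (suc r) (suc (suc q))) (above 0 (suc (suc (suc r))))
                         (above (suc r) 2) (at M 0 (suc (suc q))))
                F-pair

  -- The corner s = L − 1 lies outside the triangle; it follows from the odd parity of row 0 and
  -- of column L, all of whose other terms are paired by last-column-interior.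
  last-column-corner : at M (suc N) L ≡ not (at M 0 1)
  last-column-corner =
    xor≡true⇒≡not (trans (xor-comm (at M (suc N) L) (at M 0 1)) (peel g-first g-tail g-total))
    where
    g : ℕ → Bool
    g i = at M 0 i xor at M (L ∸ i) L
    g-total : xorSum g (suc L) ≡ false
    g-total = trans (xorSum-xor (at M 0) (λ i → at M (L ∸ i) L) (suc L))
      (cong₂ _xor_ (odd-rows 0 (s≤s z≤n))
        (trans (sym (xorSum-reverse (λ i → at M i L) (suc L)))
               (trans (xorSum-cong (suc L) (λ i _ → at-sym i L)) (odd-rows L ≤-refl))))
    g-first : g 0 ≡ false
    g-first = cong₂ _xor_ (at-diag 0) (at-diag L)
    g-middle : ∀ i → i < N → g (suc (suc i)) ≡ true
    g-middle i i<N =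
      trans (cong (at M 0 (suc (suc i)) xor_)
                  (trans (cong (λ s → at M s L) (∸-suc i<N))
                         (last-column-interior (N ∸ suc i) i
                            (trans (sym (+-suc (N ∸ suc i) i)) (m∸n+n≡m i<N)))))
            (xor-inverseʳ (at M 0 (suc (suc i))))
    g-last : g L ≡ false
    g-last = trans (cong (λ s → at M 0 L xor at M s L) (n∸n≡0 L)) (xor-same (at M 0 L))
    g-tail : xorSum (g ∘ suc ∘ suc) (suc N) ≡ true
    g-tail = trans (xorSum-suc (g ∘ suc ∘ suc) N)
                   (cong₂ _xor_ (trans (xorSum-true (g ∘ suc ∘ suc) N g-middle) N-odd) g-last)
    peel : ∀ {a b c} → a ≡ false → c ≡ true → a xor (b xor c) ≡ false → b ≡ true
    peel {b = true}  refl refl _  = refl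
    peel {b = false} refl refl ()

  last-column : ∀ s s' → s + s' ≡ L → 0 < s → 0 < s' → at M s L ≡ not (at M 0 s')
  last-column (suc r) (suc zero) e _ _ =
    subst (λ s → at M s L ≡ not (at M 0 1)) (cong suc (sym r≡N)) last-column-corner
    where
    r≡N : r ≡ N
    r≡N = suc-injective (trans (+-comm 1 r) (suc-injective e))
  last-column (suc r) (suc (suc q)) e _ _ =
    last-column-interior r q (suc-injective (suc-injective (trans (sym (+-suc-suc (suc r) q)) e)))

module RegularOddDegree {N k} {M : Matrix (suc (suc (suc N)))} (S : IsSteinhaus M)
  (R : IsRegular M (suc k)) (k-even : oddᵇ k ≡ false) (N-odd : oddᵇ N ≡ true) where
  open Steinhaus S

  odd-rows : ∀ v → v < suc (suc (suc N)) → xorSum (at M v) (suc (suc (suc N))) ≡ true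
  odd-rows v v<m =
    trans (sym (oddᵇ-ones (at M v) (suc (suc (suc N)))))
          (trans (cong oddᵇ (regular-ones M R v v<m)) (cong not k-even))

  open OddRows S odd-rows N-odd using (L; last-column)

  D : Matrix (suc N)
  D = deleteEnds M

  D-steinhaus : IsSteinhaus D
  D-steinhaus = deleteEnds-steinhaus S

  open Steinhaus D-steinhaus using () renaming (at-sym to D-at-sym)

  D-doublySymmetric : IsDoublySymmetric D
  D-doublySymmetric = doublySymmetric-from-border D-steinhaus border
    where
    border : ∀ j → 0 < j → j < suc N → at D 0 j ≡ at D (N ∸ j) N
    border j 0<j (s≤s j≤N) = begin
      at D 0 j
        ≡⟨ at-deleteEnds (s≤s z≤n) (s≤s j≤N) ⟩
      at M 1 (suc j)
        ≡⟨ at-pascal 0 j 0<j (s≤s (s≤s (m≤n⇒m≤1+n j≤N))) ⟩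
      at M 0 j xor at M 0 (suc j)
        ≡⟨ sym (xor-annihilates-not (at M 0 j) (at M 0 (suc j))) ⟩
      not (at M 0 j) xor not (at M 0 (suc j))
        ≡⟨ sym (cong₂ _xor_ (last-column (suc u) j e₁ (s≤s z≤n) 0<j)
                            (last-column u (suc j) e₂ (s≤s z≤n) (s≤s z≤n))) ⟩
      at M (suc u) L xor at M u L
        ≡⟨ sym (xor-transpose (at-pascal u (suc N) u<sN (n<1+n L))) ⟩
      at M u (suc N)
        ≡⟨ sym (at-deleteEnds (s≤s (m∸n≤m N j)) (n<1+n N)) ⟩
      at D (N ∸ j) N ∎
      where
      open ≡-Reasoning
      u : ℕ
      u = suc (N ∸ j)
      u<sN : u < suc N
      u<sN = s≤s (∸-monoʳ-< 0<j j≤N)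
      e₁ : suc u + j ≡ L
      e₁ = cong (suc ∘ suc) (m∸n+n≡m j≤N)
      e₂ : u + suc j ≡ L
      e₂ = cong suc (trans (+-suc (N ∸ j) j) (cong suc (m∸n+n≡m j≤N)))

  inner-degree : ℕ → ℕ
  inner-degree w = ones (at D w) (suc N)

  row-degree-split : ∀ w → w ≤ N →
    ones (at M (suc w)) (suc L) ≡ bit (at M 0 (suc w)) + inner-degree w + bit (not (at M 0 (suc (N ∸ w))))
  row-degree-split w w≤N =
    trans (cong (bit (at M (suc w) 0) +_) (ones-suc (λ j → at M (suc w) (suc j)) (suc N)))
      (trans (sym (+-assoc (bit (at M (suc w) 0)) _ _))
        (cong₂ _+_ (cong₂ _+_ (cong bit (at-sym (suc w) 0))
                              (ones-cong (suc N) (λ j j<sN → sym (at-deleteEnds {M = M} (s≤s w≤N) j<sN))))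
                   (cong bit (last-column (suc w) (suc (N ∸ w)) e (s≤s z≤n) (s≤s z≤n)))))
    where
    e : suc w + suc (N ∸ w) ≡ L
    e = cong suc (trans (+-suc w (N ∸ w)) (cong suc (m+[n∸m]≡n w≤N)))

  inner-degree-mirror : ∀ w → w ≤ N → inner-degree w ≡ inner-degree (N ∸ w)
  inner-degree-mirror w w≤N = trans (ones-reverse (at D w) (suc N)) (ones-cong (suc N) reflect)
    where
    reflect : ∀ i → i < suc N → at D w (N ∸ i) ≡ at D (N ∸ w) i
    reflect i (s≤s i≤N) =
      trans (proj₂ (D-doublySymmetric w (N ∸ i) (s≤s w≤N) (s≤s (m∸n≤m N i))))
        (trans (cong (λ x → at D x (N ∸ w)) (m∸[m∸n]≡n i≤N)) (D-at-sym i (N ∸ w)))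

  palindrome-and-inner-regular : ∀ w → w ≤ N →
    at M 0 (suc w) ≡ at M 0 (suc (N ∸ w)) × inner-degree w ≡ k
  palindrome-and-inner-regular w w≤N = bits-balance
    (trans (sym (row-degree-split w w≤N)) (regular-ones M R (suc w) (s≤s (s≤s (m≤n⇒m≤1+n w≤N)))))
    (trans (cong₂ (λ d c → bit (at M 0 (suc (N ∸ w))) + d + bit (not (at M 0 (suc c))))
                  (inner-degree-mirror w w≤N) (sym (m∸[m∸n]≡n w≤N)))
      (trans (sym (row-degree-split (N ∸ w) (m∸n≤m N w)))
             (regular-ones M R (suc (N ∸ w)) (s≤s (s≤s (m≤n⇒m≤1+n (m∸n≤m N w)))))))

  D-regular : IsRegular D k
  D-regular w = trans (degree≡ones D w)
    (proj₂ (palindrome-and-inner-regular (toℕ w) (s≤s⁻¹ (toℕ<n w))))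

  D-first-row-palindrome : ∀ j → 0 < j → j < suc N → at D 0 j ≡ at D 0 (suc N ∸ j)
  D-first-row-palindrome (suc j) _ (s≤s j<N) = begin
    at D 0 (suc j)
      ≡⟨ at-deleteEnds (s≤s z≤n) (s≤s j<N) ⟩
    at M 1 (suc (suc j))
      ≡⟨ at-pascal 0 (suc j) (s≤s z≤n) (s≤s (s≤s (m<n⇒m<1+n j<N))) ⟩
    at M 0 (suc j) xor at M 0 (suc (suc j))
      ≡⟨ cong₂ _xor_ (trans (palindrome j (<⇒≤ j<N)) (cong (at M 0 ∘ suc) (∸-suc j<N)))
                     (palindrome (suc j) j<N) ⟩
    at M 0 (suc c) xor at M 0 c
      ≡⟨ xor-comm (at M 0 (suc c)) (at M 0 c) ⟩
    at M 0 c xor at M 0 (suc c)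
      ≡⟨ sym (at-pascal 0 c (s≤s z≤n) (s≤s (s≤s (s≤s (m∸n≤m N (suc j)))))) ⟩
    at M 1 (suc c)
      ≡⟨ sym (at-deleteEnds (s≤s z≤n) (s≤s (∸-monoʳ-< (s≤s z≤n) j<N))) ⟩
    at D 0 c
      ≡⟨ cong (at D 0) (sym (∸-suc j<N)) ⟩
    at D 0 (N ∸ j) ∎
    where
    open ≡-Reasoning
    c : ℕ
    c = suc (N ∸ suc j)
    palindrome : ∀ w → w ≤ N → at M 0 (suc w) ≡ at M 0 (suc (N ∸ w))
    palindrome w w≤N = proj₁ (palindrome-and-inner-regular w w≤N)

  D-multiSymmetric : IsMultiSymmetric D
  D-multiSymmetric =
    multiSymmetric-from-palindrome D-steinhaus D-doublySymmetric D-first-row-palindrome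

theorem4 : (k : ℕ) → (M : Matrix (suc (suc (k + k)))) →
    1 ≤ k → ¬ (2 ∣ suc k) → IsSteinhaus M → IsRegular M (suc k) →
    IsSteinhaus (deleteEnds M) × IsRegular (deleteEnds M) k × (2 ∣ k)
      × IsMultiSymmetric (deleteEnds M)
theorem4 (suc k′) M _ ¬2∣n S R =
  D-steinhaus , D-regular , oddᵇ-false⇒even (suc k′) k-even , D-multiSymmetric
  where
  k-even : oddᵇ (suc k′) ≡ false
  k-even = trans (sym (not-involutive _)) (cong not (oddᵇ-¬even (suc (suc k′)) ¬2∣n))
  N-odd : oddᵇ (k′ + suc k′) ≡ true
  N-odd = trans (cong oddᵇ (+-suc k′ k′)) (cong not (oddᵇ-double k′))
  open RegularOddDegree S R k-even N-odd
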